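{- Let $\lambda$ be a nonzero real number. For all positive integers $n,\alpha$ and every $z$, $$ \sum_{j=0}^{n}(-1)^{j}\binom{n}{j}(z-j)_{n+\alpha,\lambda}=\sum_{r=0}^{\alpha}\binom{z-n}{r}(n+r)!{n+\alpha \brace r+n}_{\lambda}. $$
   Context: For a real parameter $\mu$ the degenerate falling factorials are $(x)_{0,\mu}=1$ and $(x)_{n,\mu}=x(x-\mu)\cdots(x-(n-1)\mu)$ for $n\ge1$; $(x)_n=(x)_{n,1}$ is the usual falling factorial, and $\binom{x}{m}=(x)_m/m!$ for integers $m\ge0$. The degenerate Stirling numbers of the second kind ${n \brace k}_{\mu}$ are defined by $(x)_{n,\mu}=\sum_{k=0}^{n}{n \brace k}_{\mu}(x)_k$. -}

module Defs where

open import Level using (Level; _⊔_)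
open import Data.Nat as ℕ using (ℕ; zero; suc; _!)
open import Data.Nat.Combinatorics using (_C_)
open import Data.Nat.Properties using (_!≢0)
open import Relation.Nullary using (¬_)
open import Algebra.Bundles using (CommutativeRing)

module RingOps {c ℓ : Level} (R : CommutativeRing c ℓ) where
  open CommutativeRing R

  ι : ℕ → Carrier
  ι zero    = 0#
  ι (suc n) = 1# + ι n

  Σ[0,_] : ℕ → (ℕ → Carrier) → Carrier
  Σ[0, zero  ] f = f 0
  Σ[0, suc n ] f = Σ[0, n ] f + f (suc n)

  sgn : ℕ → Carrier
  sgn zero    = 1#
  sgn (suc j) = - 1# * sgn j

  dfall : Carrier → Carrier → ℕ → Carrier
  dfall μ x zero    = 1#
  dfall μ x (suc n) = dfall μ x n * (x - ι n * μ)

  fall : Carrier → ℕ → Carrier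
  fall x n = dfall 1# x n

-- A field of characteristic zero (stand-in for ℝ, which agda-stdlib lacks).
record CharZeroField (c ℓ : Level) : Set (Level.suc (c ⊔ ℓ)) where
  field
    commRing : CommutativeRing c ℓ
  open CommutativeRing commRing public hiding (ring)
  open RingOps commRing public
  field
    inv       : (x : Carrier) → ¬ (x ≈ 0#) → Carrier
    inv-right : (x : Carrier) (x≉0 : ¬ (x ≈ 0#)) → x * inv x x≉0 ≈ 1#
    char0     : (n : ℕ) → ¬ (ι (suc n) ≈ 0#)

  ι≉0 : (k : ℕ) → .{{ ℕ.NonZero k }} → ¬ (ι k ≈ 0#)
  ι≉0 (suc j) = char0 j

  fact≉0 : (m : ℕ) → ¬ (ι (m !) ≈ 0#)
  fact≉0 m = ι≉0 (m !) {{ m !≢0 }}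

  binom : Carrier → ℕ → Carrier
  binom x m = fall x m * inv (ι (m !)) (fact≉0 m)

  IsDegStirling2 : Carrier → (ℕ → ℕ → Carrier) → Set (c ⊔ ℓ)
  IsDegStirling2 μ S = (n : ℕ) (x : Carrier) → dfall μ x n ≈ Σ[0, n ] (λ k → S n k * fall x k)

-- The n-th alternating binomial sum Σ_j (-1)^j C(n,j) f(j) is an n-fold backward
-- difference, and the backward difference of a falling factorial (x)_k is
-- k (x-1)_{k-1}; iterating, Σ_j (-1)^j C(n,j) (x-j)_k = (k)_n (x-n)_{k-n}.
-- Expanding (z-j)_{n+α,λ} in the basis (z-j)_k through the degenerate Stirling
-- numbers, the terms with k < n die because (k)_n = 0, and writing k = n + r
-- the surviving coefficient is (n+r)_n (z-n)_r = (n+r)! binom(z-n, r).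
module Submission where

open import Defs
open import Level using (Level)
open import Data.Nat as ℕ using (ℕ; zero; suc; _!; NonZero; _∸_; _<_; _≤_; s≤s)
open import Data.Nat.Combinatorics using (_C_; nCk+nC[k+1]≡[n+1]C[k+1]; k>n⇒nCk≡0)
open import Data.Nat.Combinatorics.Base using (_P′_)
open import Data.Nat.Combinatorics.Specification using (nP′k≡n!/[n∸k]!)
open import Data.Nat.Divisibility using (m≤n⇒m!∣n!)
open import Data.Nat.DivMod using (m/n*n≡m)
open import Data.Nat.Properties as ℕₚ using (_!≢0)
open import Data.Product using (_,_)
open import Relation.Nullary using (¬_)
open import Relation.Binary.PropositionalEquality as ≡ using (_≡_)
open import Algebra.Bundles using (CommutativeRing)
import Algebra.Properties.Ring as RingProperties
import Algebra.Properties.AbelianGroup as AbelianGroupProperties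
import Algebra.Properties.CommutativeSemigroup as CommutativeSemigroupProperties
import Algebra.Properties.Monoid.Mult as MonoidMultProperties
import Algebra.Properties.Semiring.Mult as SemiringMultProperties
import Relation.Binary.Reasoning.Setoid as SetoidReasoning

-- `n P′ k` is the falling factorial (n)_k on ℕ; it is not truncated like `_P_`.
k>n⇒nP′k≡0 : ∀ {n k} → k ℕ.> n → n P′ k ≡ 0
k>n⇒nP′k≡0 {n} k>n with ℕₚ.m≤n⇒∃[o]m+o≡n k>n
... | o , ≡.refl = ≡.cong (ℕ._* (n P′ (n ℕ.+ o))) (ℕₚ.m≤n⇒m∸n≡0 (ℕₚ.m≤m+n n o))

nP′k*[n∸k]!≡n! : ∀ {n k} → k ≤ n → (n P′ k) ℕ.* (n ∸ k) ! ≡ n !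
nP′k*[n∸k]!≡n! {n} {k} k≤n = ≡.trans
  (≡.cong (ℕ._* (n ∸ k) !) (nP′k≡n!/[n∸k]! k≤n))
  (m/n*n≡m {{(n ∸ k) !≢0}} (m≤n⇒m!∣n! (ℕₚ.m∸n≤m n k)))

module CommutativeRingLemmas {c ℓ : Level} (R : CommutativeRing c ℓ) where
  open CommutativeRing R
  open RingOps R
  open SetoidReasoning setoid
  open RingProperties ring using (-‿distribˡ-*; -0#≈0#; [y-z]x≈yx-zx; x[y-z]≈xy-xz)
  open AbelianGroupProperties +-abelianGroup using (⁻¹-∙-comm; ⁻¹-anti-homo‿-; xyx⁻¹≈y)
  open MonoidMultProperties +-monoid using (_×_; ×-homo-+)
  open SemiringMultProperties semiring using (×1-homo-*)
  open CommutativeSemigroupProperties *-commutativeSemigroup using (x∙yz≈y∙xz)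
  open CommutativeSemigroupProperties +-commutativeSemigroup using ()
    renaming (interchange to +-interchange; xy∙z≈xz∙y to +-xy∙z≈xz∙y)

  ι≈×1# : ∀ n → ι n ≈ n × 1#
  ι≈×1# zero    = refl
  ι≈×1# (suc n) = +-congˡ (ι≈×1# n)

  ι-+ : ∀ m n → ι (m ℕ.+ n) ≈ ι m + ι n
  ι-+ m n = begin
    ι (m ℕ.+ n)         ≈⟨ ι≈×1# (m ℕ.+ n) ⟩
    (m ℕ.+ n) × 1#      ≈⟨ ×-homo-+ 1# m n ⟩
    m × 1# + n × 1#     ≈⟨ +-cong (ι≈×1# m) (ι≈×1# n) ⟨
    ι m + ι n           ∎

  ι-* : ∀ m n → ι (m ℕ.* n) ≈ ι m * ι n
  ι-* m n = begin
    ι (m ℕ.* n)         ≈⟨ ι≈×1# (m ℕ.* n) ⟩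
    (m ℕ.* n) × 1#      ≈⟨ ×1-homo-* m n ⟩
    (m × 1#) * (n × 1#) ≈⟨ *-cong (ι≈×1# m) (ι≈×1# n) ⟨
    ι m * ι n           ∎

  Σ-cong : ∀ n {f g : ℕ → Carrier} → (∀ k → f k ≈ g k) → Σ[0, n ] f ≈ Σ[0, n ] g
  Σ-cong zero    f≈g = f≈g 0
  Σ-cong (suc n) f≈g = +-cong (Σ-cong n f≈g) (f≈g (suc n))

  Σ-+ : ∀ n (f g : ℕ → Carrier) → Σ[0, n ] (λ k → f k + g k) ≈ Σ[0, n ] f + Σ[0, n ] g
  Σ-+ zero    f g = refl
  Σ-+ (suc n) f g = trans (+-congʳ (Σ-+ n f g)) (+-interchange _ _ _ _)

  Σ-*ˡ : ∀ n a (f : ℕ → Carrier) → a * Σ[0, n ] f ≈ Σ[0, n ] (λ k → a * f k)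
  Σ-*ˡ zero    a f = refl
  Σ-*ˡ (suc n) a f = trans (distribˡ _ _ _) (+-congʳ (Σ-*ˡ n a f))

  Σ-neg : ∀ n (f : ℕ → Carrier) → - Σ[0, n ] f ≈ Σ[0, n ] (λ k → - f k)
  Σ-neg zero    f = refl
  Σ-neg (suc n) f = trans (sym (⁻¹-∙-comm _ _)) (+-congʳ (Σ-neg n f))

  Σ-comm : ∀ m n (h : ℕ → ℕ → Carrier) →
    Σ[0, m ] (λ j → Σ[0, n ] (h j)) ≈ Σ[0, n ] (λ k → Σ[0, m ] (λ j → h j k))
  Σ-comm zero    n h = refl
  Σ-comm (suc m) n h = trans (+-congʳ (Σ-comm m n h)) (sym (Σ-+ n _ _))

  Σ-peelˡ : ∀ n (f : ℕ → Carrier) → Σ[0, suc n ] f ≈ f 0 + Σ[0, n ] (λ j → f (suc j))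
  Σ-peelˡ zero    f = refl
  Σ-peelˡ (suc n) f = trans (+-congʳ (Σ-peelˡ n f)) (+-assoc _ _ _)

  Σ-dropˡ : ∀ n α (f : ℕ → Carrier) → (∀ k → k < n → f k ≈ 0#) →
    Σ[0, n ℕ.+ α ] f ≈ Σ[0, α ] (λ r → f (r ℕ.+ n))
  Σ-dropˡ zero    α f _  = Σ-cong α (λ r → reflexive (≡.cong f (≡.sym (ℕₚ.+-identityʳ r))))
  Σ-dropˡ (suc n) α f f₀ = begin
    Σ[0, suc (n ℕ.+ α) ] f                      ≈⟨ Σ-peelˡ (n ℕ.+ α) f ⟩
    f 0 + Σ[0, n ℕ.+ α ] (λ j → f (suc j))      ≈⟨ +-congʳ (f₀ 0 (s≤s ℕ.z≤n)) ⟩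
    0# + Σ[0, n ℕ.+ α ] (λ j → f (suc j))       ≈⟨ +-identityˡ _ ⟩
    Σ[0, n ℕ.+ α ] (λ j → f (suc j))            ≈⟨ Σ-dropˡ n α (λ j → f (suc j)) (λ k k<n → f₀ (suc k) (s≤s k<n)) ⟩
    Σ[0, α ] (λ r → f (suc (r ℕ.+ n)))          ≈⟨ Σ-cong α (λ r → reflexive (≡.cong f (≡.sym (ℕₚ.+-suc r n)))) ⟩
    Σ[0, α ] (λ r → f (r ℕ.+ suc n))            ∎

  sgn-suc : ∀ j → sgn (suc j) ≈ - sgn j
  sgn-suc j = trans (sym (-‿distribˡ-* 1# (sgn j))) (-‿cong (*-identityˡ _))

  altBinomialSum : ℕ → (ℕ → Carrier) → Carrier
  altBinomialSum n f = Σ[0, n ] (λ j → sgn j * ι (n C j) * f j)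

  -- By Pascal's rule, altBinomialSum n f is the n-fold backward difference of f.
  altBinomialSum-suc : ∀ n f →
    altBinomialSum (suc n) f ≈ altBinomialSum n f - altBinomialSum n (λ j → f (suc j))
  altBinomialSum-suc n f = begin
    altBinomialSum (suc n) f
      ≈⟨ Σ-peelˡ n _ ⟩
    term n 0 + Σ[0, n ] (λ j → sgn (suc j) * ι (suc n C suc j) * f (suc j))
      ≈⟨ +-congˡ (trans (Σ-cong n pascal) (Σ-+ n _ _)) ⟩
    term n 0 + (Σ[0, n ] (λ j → term n (suc j)) + Σ[0, n ] lower)
      ≈⟨ +-assoc _ _ _ ⟨
    (term n 0 + Σ[0, n ] (λ j → term n (suc j))) + Σ[0, n ] lower
      ≈⟨ +-cong (Σ-peelˡ n (term n)) (Σ-cong n (λ j → sym (lower≈- j))) ⟨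
    (altBinomialSum n f + term n (suc n)) + Σ[0, n ] (λ j → - shifted j)
      ≈⟨ +-cong (trans (+-congˡ top≈0) (+-identityʳ _)) (sym (Σ-neg n shifted)) ⟩
    altBinomialSum n f - altBinomialSum n (λ j → f (suc j))
      ∎
    where
    term : ℕ → ℕ → Carrier
    term m j = sgn j * ι (m C j) * f j
    lower shifted : ℕ → Carrier
    lower j = sgn (suc j) * ι (n C j) * f (suc j)
    shifted j = sgn j * ι (n C j) * f (suc j)
    pascal : ∀ j → sgn (suc j) * ι (suc n C suc j) * f (suc j) ≈ term n (suc j) + lower j
    pascal j = begin
      sgn (suc j) * ι (suc n C suc j) * f (suc j)
        ≡⟨ ≡.cong (λ b → sgn (suc j) * ι b * f (suc j)) (nCk+nC[k+1]≡[n+1]C[k+1] n j) ⟨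
      sgn (suc j) * ι (n C j ℕ.+ n C suc j) * f (suc j)
        ≈⟨ *-congʳ (*-congˡ (ι-+ (n C j) (n C suc j))) ⟩
      sgn (suc j) * (ι (n C j) + ι (n C suc j)) * f (suc j)
        ≈⟨ trans (*-congʳ (distribˡ _ _ _)) (trans (distribʳ _ _ _) (+-comm _ _)) ⟩
      term n (suc j) + lower j
        ∎
    lower≈- : ∀ j → lower j ≈ - shifted j
    lower≈- j = begin
      sgn (suc j) * ι (n C j) * f (suc j)   ≈⟨ *-congʳ (*-congʳ (sgn-suc j)) ⟩
      - sgn j * ι (n C j) * f (suc j)       ≈⟨ *-congʳ (-‿distribˡ-* _ _) ⟨
      - (sgn j * ι (n C j)) * f (suc j)     ≈⟨ -‿distribˡ-* _ _ ⟨
      - shifted j                           ∎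
    top≈0 : term n (suc n) ≈ 0#
    top≈0 = begin
      sgn (suc n) * ι (n C suc n) * f (suc n) ≡⟨ ≡.cong (λ b → sgn (suc n) * ι b * f (suc n)) (k>n⇒nCk≡0 (ℕₚ.n<1+n n)) ⟩
      sgn (suc n) * 0# * f (suc n)            ≈⟨ trans (*-congʳ (zeroʳ _)) (zeroˡ _) ⟩
      0#                                      ∎

  fall-cong : ∀ {x y} k → x ≈ y → fall x k ≈ fall y k
  fall-cong zero    x≈y = refl
  fall-cong (suc k) x≈y = *-cong (fall-cong k x≈y) (+-congʳ x≈y)

  x-ι[1+j] : ∀ x j → x - ι (suc j) ≈ (x - 1#) - ι j
  x-ι[1+j] x j = trans (+-congˡ (sym (⁻¹-∙-comm 1# (ι j)))) (sym (+-assoc _ _ _))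

  fall-suc : ∀ x k → fall x (suc k) ≈ fall x k * (x - ι k)
  fall-suc x k = *-congˡ (+-congˡ (-‿cong (*-identityʳ (ι k))))

  fall-sucˡ : ∀ x k → fall x (suc k) ≈ x * fall (x - 1#) k
  fall-sucˡ x zero = begin
    fall x 1       ≈⟨ fall-suc x 0 ⟩
    1# * (x - 0#)  ≈⟨ *-identityˡ _ ⟩
    x - 0#         ≈⟨ +-congˡ -0#≈0# ⟩
    x + 0#         ≈⟨ +-identityʳ x ⟩
    x              ≈⟨ *-identityʳ x ⟨
    x * 1#         ∎
  fall-sucˡ x (suc k) = begin
    fall x (suc (suc k))                    ≈⟨ fall-suc x (suc k) ⟩
    fall x (suc k) * (x - (1# + ι k))       ≈⟨ *-cong (fall-sucˡ x k) (x-ι[1+j] x k) ⟩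
    x * fall (x - 1#) k * ((x - 1#) - ι k)  ≈⟨ *-assoc _ _ _ ⟩
    x * (fall (x - 1#) k * ((x - 1#) - ι k)) ≈⟨ *-congˡ (fall-suc (x - 1#) k) ⟨
    x * fall (x - 1#) (suc k)               ∎

  -- The junk value ℕ.pred 0 = 0 is harmless: for k = 0 both sides are 0.
  fall-difference : ∀ x k → fall x k - fall (x - 1#) k ≈ ι k * fall (x - 1#) (ℕ.pred k)
  fall-difference x zero = begin
    1# - 1#  ≈⟨ -‿inverseʳ 1# ⟩
    0#       ≈⟨ zeroˡ 1# ⟨
    0# * 1#  ∎
  fall-difference x (suc k) = begin
    fall x (suc k) - fall (x - 1#) (suc k)
      ≈⟨ +-cong (fall-sucˡ x k) (-‿cong (fall-suc (x - 1#) k)) ⟩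
    x * F - F * ((x - 1#) - ι k)
      ≈⟨ +-congˡ (-‿cong (*-congˡ (x-ι[1+j] x k))) ⟨
    x * F - F * (x - (1# + ι k))
      ≈⟨ +-congˡ (-‿cong (trans (*-comm F _) ([y-z]x≈yx-zx F x _))) ⟩
    x * F - (x * F - (1# + ι k) * F)
      ≈⟨ +-congˡ (⁻¹-anti-homo‿- _ _) ⟩
    x * F + ((1# + ι k) * F - x * F)
      ≈⟨ +-assoc _ _ _ ⟨
    x * F + (1# + ι k) * F - x * F
      ≈⟨ xyx⁻¹≈y _ _ ⟩
    (1# + ι k) * F
      ∎
    where
    F : Carrier
    F = fall (x - 1#) k

  altBinomialSum-fall : ∀ n x k →
    altBinomialSum n (λ j → fall (x - ι j) k) ≈ ι (k P′ n) * fall (x - ι n) (k ∸ n)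
  altBinomialSum-fall zero    x k = *-congʳ (*-identityˡ _)
  altBinomialSum-fall (suc n) x k = begin
    altBinomialSum (suc n) (λ j → fall (x - ι j) k)
      ≈⟨ altBinomialSum-suc n _ ⟩
    altBinomialSum n (λ j → fall (x - ι j) k) - altBinomialSum n (λ j → fall (x - ι (suc j)) k)
      ≈⟨ +-congˡ (-‿cong (Σ-cong n (λ j → *-congˡ (fall-cong k (x-ι[1+j] x j))))) ⟩
    altBinomialSum n (λ j → fall (x - ι j) k) - altBinomialSum n (λ j → fall ((x - 1#) - ι j) k)
      ≈⟨ +-cong (altBinomialSum-fall n x k) (-‿cong (altBinomialSum-fall n (x - 1#) k)) ⟩
    ι kPn * fall y m - ι kPn * fall ((x - 1#) - ι n) m
      ≈⟨ +-congˡ (-‿cong (*-congˡ (fall-cong m (sym y-1)))) ⟩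
    ι kPn * fall y m - ι kPn * fall (y - 1#) m
      ≈⟨ x[y-z]≈xy-xz _ _ _ ⟨
    ι kPn * (fall y m - fall (y - 1#) m)
      ≈⟨ *-congˡ (fall-difference y m) ⟩
    ι kPn * (ι m * fall (y - 1#) (ℕ.pred m))
      ≈⟨ trans (sym (*-assoc _ _ _)) (*-congʳ (*-comm _ _)) ⟩
    ι m * ι kPn * fall (y - 1#) (ℕ.pred m)
      ≈⟨ *-cong (sym (ι-* m kPn)) (fall-cong (ℕ.pred m) (trans y-1 (sym (x-ι[1+j] x n)))) ⟩
    ι (m ℕ.* kPn) * fall (x - ι (suc n)) (ℕ.pred m)
      ≡⟨ ≡.cong (λ e → ι (m ℕ.* kPn) * fall (x - ι (suc n)) e) (ℕₚ.pred[m∸n]≡m∸[1+n] k n) ⟩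
    ι (k P′ suc n) * fall (x - ι (suc n)) (k ∸ suc n)
      ∎
    where
    kPn m : ℕ
    kPn = k P′ n
    m = k ∸ n
    y : Carrier
    y = x - ι n
    y-1 : y - 1# ≈ (x - 1#) - ι n
    y-1 = +-xy∙z≈xz∙y x (- ι n) (- 1#)

  altBinomialSum-Σfall : ∀ n N (a : ℕ → Carrier) x →
    altBinomialSum n (λ j → Σ[0, N ] (λ k → a k * fall (x - ι j) k))
      ≈ Σ[0, N ] (λ k → a k * (ι (k P′ n) * fall (x - ι n) (k ∸ n)))
  altBinomialSum-Σfall n N a x = begin
    Σ[0, n ] (λ j → sgn j * ι (n C j) * Σ[0, N ] (λ k → a k * fall (x - ι j) k))
      ≈⟨ Σ-cong n (λ j → Σ-*ˡ N _ _) ⟩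
    Σ[0, n ] (λ j → Σ[0, N ] (λ k → sgn j * ι (n C j) * (a k * fall (x - ι j) k)))
      ≈⟨ Σ-comm n N _ ⟩
    Σ[0, N ] (λ k → Σ[0, n ] (λ j → sgn j * ι (n C j) * (a k * fall (x - ι j) k)))
      ≈⟨ Σ-cong N (λ k → trans (Σ-cong n (λ j → x∙yz≈y∙xz _ _ _)) (sym (Σ-*ˡ n _ _))) ⟩
    Σ[0, N ] (λ k → a k * altBinomialSum n (λ j → fall (x - ι j) k))
      ≈⟨ Σ-cong N (λ k → *-congˡ (altBinomialSum-fall n x k)) ⟩
    Σ[0, N ] (λ k → a k * (ι (k P′ n) * fall (x - ι n) (k ∸ n)))
      ∎

  -- The n-th difference annihilates the falling factorials of degree below n.
  altBinomialSum-fallExpansion : ∀ n α (a : ℕ → Carrier) (g : Carrier → Carrier) →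
    (∀ x → g x ≈ Σ[0, n ℕ.+ α ] (λ k → a k * fall x k)) → ∀ x →
    altBinomialSum n (λ j → g (x - ι j))
      ≈ Σ[0, α ] (λ r → a (r ℕ.+ n) * (ι ((r ℕ.+ n) P′ n) * fall (x - ι n) r))
  altBinomialSum-fallExpansion n α a g expansion x = begin
    altBinomialSum n (λ j → g (x - ι j))
      ≈⟨ Σ-cong n (λ j → *-congˡ (expansion (x - ι j))) ⟩
    altBinomialSum n (λ j → Σ[0, n ℕ.+ α ] (λ k → a k * fall (x - ι j) k))
      ≈⟨ altBinomialSum-Σfall n (n ℕ.+ α) a x ⟩
    Σ[0, n ℕ.+ α ] term
      ≈⟨ Σ-dropˡ n α term low-vanishes ⟩
    Σ[0, α ] (λ r → term (r ℕ.+ n))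
      ≈⟨ Σ-cong α (λ r → *-congˡ (*-congˡ (reflexive (≡.cong (fall (x - ι n)) (ℕₚ.m+n∸n≡m r n))))) ⟩
    Σ[0, α ] (λ r → a (r ℕ.+ n) * (ι ((r ℕ.+ n) P′ n) * fall (x - ι n) r))
      ∎
    where
    term : ℕ → Carrier
    term k = a k * (ι (k P′ n) * fall (x - ι n) (k ∸ n))
    low-vanishes : ∀ k → k < n → term k ≈ 0#
    low-vanishes k k<n = begin
      a k * (ι (k P′ n) * fall (x - ι n) (k ∸ n))
        ≡⟨ ≡.cong (λ p → a k * (ι p * fall (x - ι n) (k ∸ n))) (k>n⇒nP′k≡0 k<n) ⟩
      a k * (0# * fall (x - ι n) (k ∸ n))
        ≈⟨ trans (*-congˡ (zeroˡ _)) (zeroʳ _) ⟩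
      0#
        ∎

module CharZeroFieldLemmas {c ℓ : Level} (F : CharZeroField c ℓ) where
  open CharZeroField F
  open CommutativeRingLemmas commRing using (ι-*)
  open SetoidReasoning setoid

  binom*ι[m!]≈fall : ∀ x m → binom x m * ι (m !) ≈ fall x m
  binom*ι[m!]≈fall x m = begin
    fall x m * inv (ι (m !)) (fact≉0 m) * ι (m !)    ≈⟨ *-assoc _ _ _ ⟩
    fall x m * (inv (ι (m !)) (fact≉0 m) * ι (m !))  ≈⟨ *-congˡ (trans (*-comm _ _) (inv-right _ _)) ⟩
    fall x m * 1#                                    ≈⟨ *-identityʳ _ ⟩
    fall x m                                         ∎

  [r+n]P′n*fall≈binom*[n+r]! : ∀ n r y →
    ι ((r ℕ.+ n) P′ n) * fall y r ≈ binom y r * ι ((n ℕ.+ r) !)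
  [r+n]P′n*fall≈binom*[n+r]! n r y = begin
    ι p * fall y r               ≈⟨ *-comm _ _ ⟩
    fall y r * ι p               ≈⟨ *-congʳ (binom*ι[m!]≈fall y r) ⟨
    binom y r * ι (r !) * ι p    ≈⟨ *-assoc _ _ _ ⟩
    binom y r * (ι (r !) * ι p)  ≈⟨ *-congˡ (trans (ι-* p (r !)) (*-comm _ _)) ⟨
    binom y r * ι (p ℕ.* r !)    ≡⟨ ≡.cong (λ m → binom y r * ι m) p*r!≡[n+r]! ⟩
    binom y r * ι ((n ℕ.+ r) !)  ∎
    where
    p : ℕ
    p = (r ℕ.+ n) P′ n
    p*r!≡[n+r]! : p ℕ.* r ! ≡ (n ℕ.+ r) !
    p*r!≡[n+r]! = ≡.trans (≡.cong (λ m → p ℕ.* m !) (≡.sym (ℕₚ.m+n∸n≡m r n)))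
      (≡.trans (nP′k*[n∸k]!≡n! (ℕₚ.m≤n+m n r)) (≡.cong _! (ℕₚ.+-comm r n)))

theorem2p7 : ∀ {c ℓ : Level} (F : CharZeroField c ℓ) →
    let open CharZeroField F in
    (λ' : Carrier) → ¬ (λ' ≈ 0#) →
    (S : ℕ → ℕ → Carrier) → IsDegStirling2 λ' S →
    (n α : ℕ) → .{{ NonZero n }} → .{{ NonZero α }} → (z : Carrier) →
    Σ[0, n ] (λ j → sgn j * ι (n C j) * dfall λ' (z - ι j) (n ℕ.+ α))
      ≈ Σ[0, α ] (λ r → binom (z - ι n) r * ι ((n ℕ.+ r) !) * S (n ℕ.+ α) (r ℕ.+ n))
theorem2p7 F λ' _ S isStirling n α z = begin
    altBinomialSum n (λ j → dfall λ' (z - ι j) N)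
      ≈⟨ altBinomialSum-fallExpansion n α (S N) (λ x → dfall λ' x N) (isStirling N) z ⟩
    Σ[0, α ] (λ r → S N (r ℕ.+ n) * (ι ((r ℕ.+ n) P′ n) * fall (z - ι n) r))
      ≈⟨ Σ-cong α (λ r → trans (*-comm _ _) (*-congʳ ([r+n]P′n*fall≈binom*[n+r]! n r (z - ι n)))) ⟩
    Σ[0, α ] (λ r → binom (z - ι n) r * ι ((n ℕ.+ r) !) * S N (r ℕ.+ n))
      ∎
  where
  open CharZeroField F
  open CommutativeRingLemmas commRing
  open CharZeroFieldLemmas F
  open SetoidReasoning setoid
  N : ℕ
  N = n ℕ.+ α
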